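{- Let $G=(V,E)$ be an undirected graph with $n$ nodes and $m$ edges, and let $\chi$ be any monitor placement for $G$. Under either the $\mathrm{CSP}$ or the $\mathrm{CAP}^-$ routing mechanism, $\mu(G\mid\chi)\le\min\{n,\lceil 2m/n\rceil\}$.
   Context: A monitor placement $\chi=(\mathfrak m,\mathfrak M)$ for $G=(V,E)$ specifies a set $\mathfrak m\subseteq V$ of input nodes and a set $\mathfrak M\subseteq V$ of output nodes. The set of measurement paths $\mathbb P(G\mid\chi)$ depends on the routing mechanism: under $\mathrm{CSP}$ it consists of all simple (no repeated node) paths from a node of $\mathfrak m$ to a different node of $\mathfrak M$; under $\mathrm{CAP}^-$ it consists of all walks (repeated nodes/edges allowed) starting at a node of $\mathfrak m$ and ending at a node of $\mathfrak M$, except that the single-node path consisting of one node $v\in\mathfrak m\cap\mathfrak M$ is not allowed. For a node $v$, $\mathbb P(v)$ is the set of measurement paths through $v$, and $\mathbb P(U)=\bigcup_{u\in U}\mathbb P(u)$. $V$ is $k$-identifiable if for all $U,W\subseteq V$ with $U\neq W$ and $|U|,|W|\le k$, $\mathbb P(U)\neq\mathbb P(W)$. $\mu(G\mid\chi)$ is the largest $k\ge0$ such that $V$ is $k$-identifiable with respect to $\mathbb P(G\mid\chi)$. -}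

module Defs where

open import Data.Nat using (ℕ; zero; suc; _+_; _*_; _∸_; _≤_; NonZero)
open import Data.Nat.DivMod using (_/_)
open import Data.Bool using (Bool; true; false; T; _∧_)
open import Data.Fin using (Fin; toℕ)
open import Data.Nat using (_<ᵇ_)
open import Data.Fin.Subset using (Subset; ∣_∣)
import Data.Fin.Subset as Sub
open import Data.List using (List; []; _∷_; length; filterᵇ; cartesianProduct; allFin; head; last)
open import Data.List.Membership.Propositional using (_∈_)
open import Data.List.Relation.Unary.Unique.Propositional using (Unique)
open import Data.List.Relation.Unary.Linked using (Linked)
open import Data.Maybe using (just)
open import Data.Product using (Σ; _×_; _,_; proj₁; proj₂)
open import Relation.Binary.PropositionalEquality using (_≡_)
open import Relation.Nullary using (¬_)
open import Function.Bundles using (_⇔_)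

record Graph (n : ℕ) : Set where
  field
    adj       : Fin n → Fin n → Bool
    adj-sym   : ∀ i j → adj i j ≡ adj j i
    adj-irrefl : ∀ i → adj i i ≡ false

open Graph public

Adj : ∀ {n} → Graph n → Fin n → Fin n → Set
Adj G i j = T (adj G i j)

-- The edge set: unordered pairs {i , j} (represented with i < j) that are adjacent.
edges : ∀ {n} → Graph n → List (Fin n × Fin n)
edges {n} G = filterᵇ (λ p → (toℕ (proj₁ p) <ᵇ toℕ (proj₂ p)) ∧ adj G (proj₁ p) (proj₂ p))
                      (cartesianProduct (allFin n) (allFin n))

numEdges : ∀ {n} → Graph n → ℕ
numEdges G = length (edges G)

⌈_/_⌉ : (a b : ℕ) → .{{NonZero b}} → ℕ
⌈ a / b ⌉ = (a + b ∸ 1) / b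

record Placement (n : ℕ) : Set where
  constructor placement
  field
    inputs  : Subset n
    outputs : Subset n

open Placement public

data Routing : Set where
  CSP CAP⁻ : Routing

Walk : ∀ {n} → Graph n → List (Fin n) → Set
Walk G p = Linked (Adj G) p

StartsIn : ∀ {n} → Subset n → List (Fin n) → Set
StartsIn S p = Σ _ λ v → (head p ≡ just v) × (v Sub.∈ S)

EndsIn : ∀ {n} → Subset n → List (Fin n) → Set
EndsIn S p = Σ _ λ v → (last p ≡ just v) × (v Sub.∈ S)

MeasPath : ∀ {n} → Routing → Graph n → Placement n → List (Fin n) → Set
MeasPath CSP  G χ p =
  Walk G p × Unique p ×
  (Σ _ λ s → Σ _ λ t → (head p ≡ just s) × (last p ≡ just t) ×
     (s Sub.∈ inputs χ) × (t Sub.∈ outputs χ) × ¬ (s ≡ t))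
MeasPath CAP⁻ G χ p =
  Walk G p × StartsIn (inputs χ) p × EndsIn (outputs χ) p ×
  ¬ (Σ _ λ v → p ≡ v ∷ [])

PathsThrough : ∀ {n} → Routing → Graph n → Placement n → Subset n → List (Fin n) → Set
PathsThrough r G χ U p = MeasPath r G χ p × Σ _ λ u → (u Sub.∈ U) × (u ∈ p)

SamePaths : ∀ {n} → Routing → Graph n → Placement n → Subset n → Subset n → Set
SamePaths r G χ U W = ∀ p → PathsThrough r G χ U p ⇔ PathsThrough r G χ W p

Identifiable : ∀ {n} → Routing → Graph n → Placement n → ℕ → Set
Identifiable {n} r G χ k =
  (U W : Subset n) → ¬ (U ≡ W) → ∣ U ∣ ≤ k → ∣ W ∣ ≤ k → ¬ SamePaths r G χ U W

module Submission where

-- Every measurement path (CSP or CAP⁻) has at least two nodes and is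
-- a walk, so each node v on such a path has a neighbour on the same path.
-- Hence a path meets the closed neighbourhood N[v] = N(v) ∪ {v} iff it meets
-- the open neighbourhood N(v): P(N(v)) = P(N[v]).  Since v ∉ N(v) these sets
-- differ, and |N(v)| ≤ deg v, |N[v]| ≤ deg v + 1; so k-identifiability
-- forces k ≤ deg v for every node v.

open import Defs
open import Data.Nat using (ℕ; suc; _≤_; _*_; _⊓_)
open import Data.Nat using (zero; _+_; _∸_; _<_; _<ᵇ_; z≤n; s≤s; NonZero; _≤?_)
open import Relation.Binary.Definitions using (tri<; tri≈; tri>)
open import Data.Nat.Properties
open import Data.Nat.DivMod using (_/_; m*n/n≡m; /-monoˡ-≤)
open import Algebra.Properties.CommutativeMonoid.Sum +-0-commutativeMonoid
  using (sum-syntax; ∑-distrib-+; ∑-comm; sum-cong-≗)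
open import Data.Bool using (Bool; true; false; T; T?; _∧_)
open import Data.Bool.Properties using (T-≡)
open import Data.Fin using (Fin; toℕ) renaming (zero to fzero; suc to fsuc)
open import Data.Fin.Properties using (toℕ-injective)
open import Data.Fin.Subset using (Subset; ∣_∣; _∪_; ⁅_⁆)
import Data.Fin.Subset as Sub
open import Data.Fin.Subset.Properties using (x∈p∪q⁻; x∈p∪q⁺; x∈⁅x⁆; x∈⁅y⁆⇒x≡y; ∣⁅x⁆∣≡1; ∣p∣≤n)
import Data.Vec as Vec
open import Data.Vec using (_∷_)
open import Data.Vec.Properties using (lookup∘tabulate; lookup⇒[]=; []=⇒lookup)
open import Data.List as List using (List; []; _∷_; length; filterᵇ; cartesianProduct; allFin; _++_)
open import Data.List.Properties using (filter-++; length-++)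
open import Data.List.Membership.Propositional using (_∈_)
open import Data.List.Relation.Unary.Any using (here; there)
open import Data.List.Relation.Unary.Linked using (Linked; _∷_)
open import Data.Product using (Σ; _×_; _,_; proj₁; proj₂)
open import Data.Sum using (_⊎_; inj₁; inj₂)
open import Data.Unit using (tt)
open import Data.Empty using (⊥-elim)
open import Relation.Binary.PropositionalEquality
open import Relation.Nullary using (¬_; yes; no)
open import Function.Bundles using (mk⇔; Equivalence)

𝟙 : Bool → ℕ
𝟙 true  = 1
𝟙 false = 0

length-filterᵇ-++ : ∀ {A : Set} (p : A → Bool) (xs ys : List A) →
  length (filterᵇ p (xs ++ ys)) ≡ length (filterᵇ p xs) + length (filterᵇ p ys)
length-filterᵇ-++ p xs ys =
  trans (cong length (filter-++ (λ x → T? (p x)) xs ys)) (length-++ (filterᵇ p xs))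

length-filterᵇ-map : ∀ {A B : Set} (p : B → Bool) (f : A → B) (xs : List A) →
  length (filterᵇ p (List.map f xs)) ≡ length (filterᵇ (λ x → p (f x)) xs)
length-filterᵇ-map p f [] = refl
length-filterᵇ-map p f (x ∷ xs) with p (f x)
... | true  = cong suc (length-filterᵇ-map p f xs)
... | false = length-filterᵇ-map p f xs

length-filterᵇ-tabulate : ∀ {A : Set} {n} (p : A → Bool) (f : Fin n → A) →
  length (filterᵇ p (List.tabulate f)) ≡ ∑[ i < n ] 𝟙 (p (f i))
length-filterᵇ-tabulate {n = zero}  p f = refl
length-filterᵇ-tabulate {n = suc n} p f with p (f fzero)
... | true  = cong suc (length-filterᵇ-tabulate p (λ i → f (fsuc i)))
... | false = length-filterᵇ-tabulate p (λ i → f (fsuc i))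

length-filterᵇ-cartesian : ∀ {A B : Set} {n} (p : A × B → Bool) (f : Fin n → A) (ys : List B) →
  length (filterᵇ p (cartesianProduct (List.tabulate f) ys))
    ≡ ∑[ i < n ] length (filterᵇ (λ y → p (f i , y)) ys)
length-filterᵇ-cartesian {n = zero}  p f ys = refl
length-filterᵇ-cartesian {n = suc n} p f ys = begin
  length (filterᵇ p (List.map (f fzero ,_) ys ++ cartesianProduct (List.tabulate (λ i → f (fsuc i))) ys))
    ≡⟨ length-filterᵇ-++ p (List.map (f fzero ,_) ys) _ ⟩
  length (filterᵇ p (List.map (f fzero ,_) ys)) + length (filterᵇ p (cartesianProduct (List.tabulate (λ i → f (fsuc i))) ys))
    ≡⟨ cong₂ _+_ (length-filterᵇ-map p (f fzero ,_) ys) (length-filterᵇ-cartesian p (λ i → f (fsuc i)) ys) ⟩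
  length (filterᵇ (λ y → p (f fzero , y)) ys) + ∑[ i < n ] length (filterᵇ (λ y → p (f (fsuc i) , y)) ys)
    ∎
  where open ≡-Reasoning

∣tabulate∣ : ∀ {n} (f : Fin n → Bool) → ∣ Vec.tabulate f ∣ ≡ ∑[ i < n ] 𝟙 (f i)
∣tabulate∣ {zero}  f = refl
∣tabulate∣ {suc n} f with f fzero
... | true  = cong suc (∣tabulate∣ (λ i → f (fsuc i)))
... | false = ∣tabulate∣ (λ i → f (fsuc i))

∣p∪q∣≤∣p∣+∣q∣ : ∀ {n} (p q : Subset n) → ∣ p ∪ q ∣ ≤ ∣ p ∣ + ∣ q ∣
∣p∪q∣≤∣p∣+∣q∣ Vec.[]        Vec.[]         = z≤n
∣p∪q∣≤∣p∣+∣q∣ (true  ∷ p)   (true  ∷ q)   = s≤s (≤-trans (∣p∪q∣≤∣p∣+∣q∣ p q)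
                                               (≤-trans (n≤1+n _) (≤-reflexive (sym (+-suc ∣ p ∣ ∣ q ∣)))))
∣p∪q∣≤∣p∣+∣q∣ (true  ∷ p)   (false ∷ q)   = s≤s (∣p∪q∣≤∣p∣+∣q∣ p q)
∣p∪q∣≤∣p∣+∣q∣ (false ∷ p)   (true  ∷ q)   = ≤-trans (s≤s (∣p∪q∣≤∣p∣+∣q∣ p q)) (≤-reflexive (sym (+-suc ∣ p ∣ ∣ q ∣)))
∣p∪q∣≤∣p∣+∣q∣ (false ∷ p)   (false ∷ q)   = ∣p∪q∣≤∣p∣+∣q∣ p q

∑-lower-bound : ∀ {n} k (f : Fin n → ℕ) → (∀ i → k ≤ f i) → n * k ≤ ∑[ i < n ] f i
∑-lower-bound {zero}  k f k≤f = z≤n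
∑-lower-bound {suc n} k f k≤f = +-mono-≤ (k≤f fzero) (∑-lower-bound k (λ i → f (fsuc i)) (λ i → k≤f (fsuc i)))

≤-ceil-div : ∀ k a d .{{_ : NonZero d}} → d * k ≤ a → k ≤ ⌈ a / d ⌉
≤-ceil-div k a d@(suc d-1) dk≤a = begin
  k                       ≡⟨ m*n/n≡m k d ⟨
  k * d / d               ≤⟨ /-monoˡ-≤ d (≤-trans (≤-reflexive (*-comm k d)) dk≤a′) ⟩
  (a + d ∸ 1) / d         ∎
  where
  open ≤-Reasoning
  dk≤a′ : d * k ≤ a + d ∸ 1
  dk≤a′ = ≤-trans dk≤a (≤-trans (m≤m+n a d-1) (≤-reflexive (sym (+-∸-assoc a (s≤s z≤n)))))

<ᵇ-true : ∀ {a b} → a < b → (a <ᵇ b) ≡ true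
<ᵇ-true {a} {b} a<b with a <ᵇ b | <⇒<ᵇ a<b
... | true | _ = refl

<ᵇ-false : ∀ {a b} → ¬ a < b → (a <ᵇ b) ≡ false
<ᵇ-false {a} {b} a≮b with a <ᵇ b in eq
... | true  = ⊥-elim (a≮b (<ᵇ⇒< a b (subst T (sym eq) tt)))
... | false = refl

module _ {n : ℕ} (G : Graph n) where

  nbhd : Fin n → Subset n
  nbhd v = Vec.tabulate (adj G v)

  closedNbhd : Fin n → Subset n
  closedNbhd v = nbhd v ∪ ⁅ v ⁆

  degree : Fin n → ℕ
  degree v = ∣ nbhd v ∣

  Adj-sym : ∀ {u v} → Adj G u v → Adj G v u
  Adj-sym {u} {v} = subst T (adj-sym G u v)

  Adj⇒∈nbhd : ∀ {u v} → Adj G v u → u Sub.∈ nbhd v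
  Adj⇒∈nbhd {u} {v} vu = lookup⇒[]= u (nbhd v) (trans (lookup∘tabulate (adj G v) u) (Equivalence.to T-≡ vu))

  v∉nbhd : ∀ v → ¬ (v Sub.∈ nbhd v)
  v∉nbhd v v∈ = subst T (trans (sym ([]=⇒lookup v∈)) (trans (lookup∘tabulate (adj G v) v) (adj-irrefl G v))) tt

  nbhd≢closedNbhd : ∀ v → ¬ (nbhd v ≡ closedNbhd v)
  nbhd≢closedNbhd v eq = v∉nbhd v (subst (v Sub.∈_) (sym eq) (x∈p∪q⁺ (inj₂ (x∈⁅x⁆ v))))

  ∣closedNbhd∣≤1+degree : ∀ v → ∣ closedNbhd v ∣ ≤ suc (degree v)
  ∣closedNbhd∣≤1+degree v = ≤-trans (∣p∪q∣≤∣p∣+∣q∣ (nbhd v) ⁅ v ⁆)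
    (≤-reflexive (trans (cong (degree v +_) (∣⁅x⁆∣≡1 v)) (+-comm (degree v) 1)))

  Ordered : Fin n → Fin n → Bool
  Ordered i j = (toℕ i <ᵇ toℕ j) ∧ adj G i j

  adj-split : ∀ i j → 𝟙 (adj G i j) ≡ 𝟙 (Ordered i j) + 𝟙 (Ordered j i)
  adj-split i j with <-cmp (toℕ i) (toℕ j)
  ... | tri< i<j _ j≮i rewrite <ᵇ-true i<j | <ᵇ-false j≮i = sym (+-identityʳ _)
  ... | tri> i≮j _ j<i rewrite <ᵇ-false i≮j | <ᵇ-true j<i = cong 𝟙 (adj-sym G i j)
  ... | tri≈ _ i≡j _ rewrite toℕ-injective i≡j | <ᵇ-false (n≮n (toℕ j)) | adj-irrefl G j = refl

  numEdges≡∑∑Ordered : numEdges G ≡ ∑[ i < n ] ∑[ j < n ] 𝟙 (Ordered i j)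
  numEdges≡∑∑Ordered =
    trans (length-filterᵇ-cartesian (λ e → Ordered (proj₁ e) (proj₂ e)) (λ i → i) (allFin n))
          (sum-cong-≗ (λ i → length-filterᵇ-tabulate (Ordered i) (λ j → j)))

  handshake : ∑[ v < n ] degree v ≡ 2 * numEdges G
  handshake = begin
    ∑[ v < n ] degree v
      ≡⟨ sum-cong-≗ (λ v → ∣tabulate∣ (adj G v)) ⟩
    ∑[ i < n ] ∑[ j < n ] 𝟙 (adj G i j)
      ≡⟨ sum-cong-≗ (λ i → sum-cong-≗ (adj-split i)) ⟩
    ∑[ i < n ] ∑[ j < n ] (𝟙 (Ordered i j) + 𝟙 (Ordered j i))
      ≡⟨ sum-cong-≗ (λ i → ∑-distrib-+ (λ j → 𝟙 (Ordered i j)) (λ j → 𝟙 (Ordered j i))) ⟩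
    ∑[ i < n ] (∑[ j < n ] 𝟙 (Ordered i j) + ∑[ j < n ] 𝟙 (Ordered j i))
      ≡⟨ ∑-distrib-+ (λ i → ∑[ j < n ] 𝟙 (Ordered i j)) (λ i → ∑[ j < n ] 𝟙 (Ordered j i)) ⟩
    m + ∑[ i < n ] ∑[ j < n ] 𝟙 (Ordered j i)
      ≡⟨ cong (m +_) (∑-comm (λ i j → 𝟙 (Ordered j i))) ⟩
    m + m
      ≡⟨ cong (m +_) (+-identityʳ m) ⟨
    2 * m
      ≡⟨ cong (2 *_) (sym numEdges≡∑∑Ordered) ⟩
    2 * numEdges G
      ∎
    where
    open ≡-Reasoning
    m : ℕ
    m = ∑[ i < n ] ∑[ j < n ] 𝟙 (Ordered i j)

data AtLeastTwo {A : Set} : List A → Set where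
  two : ∀ {x y ys} → AtLeastTwo (x ∷ y ∷ ys)

linked-partner : ∀ {A : Set} (R : A → A → Set) {xs : List A} {v : A} →
  Linked R xs → AtLeastTwo xs → v ∈ xs → Σ A λ u → u ∈ xs × (R v u ⊎ R u v)
linked-partner R (r ∷ _) two (here refl)         = _ , there (here refl) , inj₁ r
linked-partner R (r ∷ _) two (there (here refl)) = _ , here refl , inj₂ r
linked-partner R {_ ∷ _ ∷ []} _ two (there (there ()))
linked-partner R {_ ∷ _ ∷ _ ∷ _} (_ ∷ l) two (there (there v∈))
  with u , u∈ , vRu ← linked-partner R l two (there v∈) = u , there u∈ , vRu

measPath-walk : ∀ {n} (r : Routing) (G : Graph n) (χ : Placement n) {p} → MeasPath r G χ p → Walk G p
measPath-walk CSP  G χ = proj₁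
measPath-walk CAP⁻ G χ = proj₁

-- Measurement paths have at least two nodes: a CSP path joins two distinct
-- nodes, and CAP⁻ excludes single-node paths.
measPath-atLeastTwo : ∀ {n} (r : Routing) (G : Graph n) (χ : Placement n) (p : List (Fin n)) →
  MeasPath r G χ p → AtLeastTwo p
measPath-atLeastTwo CSP  G χ []          (_ , _ , _ , _ , () , _)
measPath-atLeastTwo CSP  G χ (_ ∷ [])    (_ , _ , _ , _ , refl , refl , _ , _ , s≢t) = ⊥-elim (s≢t refl)
measPath-atLeastTwo CSP  G χ (_ ∷ _ ∷ _) _ = two
measPath-atLeastTwo CAP⁻ G χ []          (_ , (_ , () , _) , _)
measPath-atLeastTwo CAP⁻ G χ (x ∷ [])    (_ , _ , _ , not-single) = ⊥-elim (not-single (x , refl))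
measPath-atLeastTwo CAP⁻ G χ (_ ∷ _ ∷ _) _ = two

module _ {n : ℕ} (r : Routing) (G : Graph n) (χ : Placement n) where

  neighbour-on-path : ∀ {p v} → MeasPath r G χ p → v ∈ p → Σ (Fin n) λ u → u ∈ p × Adj G v u
  neighbour-on-path mp v∈
    with linked-partner (Adj G) (measPath-walk r G χ mp) (measPath-atLeastTwo r G χ _ mp) v∈
  ... | u , u∈ , inj₁ vu = u , u∈ , vu
  ... | u , u∈ , inj₂ uv = u , u∈ , Adj-sym G uv

  nbhd-closedNbhd-samePaths : ∀ v → SamePaths r G χ (nbhd G v) (closedNbhd G v)
  nbhd-closedNbhd-samePaths v p = mk⇔
    (λ { (mp , u , u∈N , u∈p) → mp , u , x∈p∪q⁺ (inj₁ u∈N) , u∈p })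
    (λ { (mp , u , u∈N[v] , u∈p) → mp , meets-nbhd mp u∈N[v] u∈p })
    where
    meets-nbhd : MeasPath r G χ p → ∀ {u} → u Sub.∈ closedNbhd G v → u ∈ p →
                 Σ (Fin n) λ w → w Sub.∈ nbhd G v × w ∈ p
    meets-nbhd mp {u} u∈N[v] u∈p with x∈p∪q⁻ (nbhd G v) ⁅ v ⁆ u∈N[v]
    ... | inj₁ u∈N = u , u∈N , u∈p
    ... | inj₂ u∈⁅v⁆ with refl ← x∈⁅y⁆⇒x≡y v u∈⁅v⁆
                     | w , w∈p , vw ← neighbour-on-path mp u∈p = w , Adj⇒∈nbhd G vw , w∈p

  -- k-identifiability forces k ≤ deg v for every node v, since otherwise
  -- N(v) ≠ N[v] would be two sets of size ≤ k with the same paths.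
  identifiable⇒≤degree : ∀ {k} → Identifiable r G χ k → ∀ v → k ≤ degree G v
  identifiable⇒≤degree {k} idf v with k ≤? degree G v
  ... | yes k≤deg = k≤deg
  ... | no  k≰deg = ⊥-elim (idf (nbhd G v) (closedNbhd G v) (nbhd≢closedNbhd G v)
                                (<⇒≤ deg<k) (≤-trans (∣closedNbhd∣≤1+degree G v) deg<k)
                                (nbhd-closedNbhd-samePaths v))
    where
    deg<k : degree G v < k
    deg<k = ≰⇒> k≰deg

corollary1 : (n : ℕ) (G : Graph (suc n)) (χ : Placement (suc n)) (r : Routing) (k : ℕ) →
             Identifiable r G χ k → k ≤ (suc n) ⊓ ⌈ 2 * numEdges G / suc n ⌉
corollary1 n G χ r k idf = ⊓-glb k≤n k≤⌈2m/n⌉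
  where
  k≤degree : ∀ v → k ≤ degree G v
  k≤degree = identifiable⇒≤degree r G χ idf

  k≤n : k ≤ suc n
  k≤n = ≤-trans (k≤degree fzero) (∣p∣≤n (nbhd G fzero))

  n*k≤2m : suc n * k ≤ 2 * numEdges G
  n*k≤2m = subst (suc n * k ≤_) (handshake G) (∑-lower-bound k (degree G) k≤degree)

  k≤⌈2m/n⌉ : k ≤ ⌈ 2 * numEdges G / suc n ⌉
  k≤⌈2m/n⌉ = ≤-ceil-div k (2 * numEdges G) (suc n) n*k≤2m
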